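{- Let $n\ge 3$ be an integer. Consider the subtraction game on a single pile in which a move consists of removing $s$ stones, where $s\in\{2,4n,4n+2\}$ and at least $s$ stones are present; a player unable to move loses. Let $\mathcal{G}(x)$ be the Grundy number of the position with $x$ stones. Then for every $x\in\mathbb{N}$, $$\mathcal{G}(x)=\operatorname{mex}\{\mathcal{G}(x+2),\ \mathcal{G}(x+4n),\ \mathcal{G}(x+4n+2)\}.$$
   Context: $\operatorname{mex}(S)$ is the least nonnegative integer not in the set $S$. The Grundy numbers are defined recursively by $\mathcal{G}(x)=\operatorname{mex}\{\mathcal{G}(x-s): s\in\{2,4n,4n+2\},\ x-s\ge 0\}$. -}

module Defs where

open import Data.Nat using (ℕ; zero; suc; _+_; _*_; _∸_; _≤ᵇ_; _≡ᵇ_)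
open import Data.Bool using (Bool; true; false; if_then_else_; _∨_)
open import Data.List using (List; []; _∷_; length; map; reverse)

elemᵇ : ℕ → List ℕ → Bool
elemᵇ m []       = false
elemᵇ m (y ∷ ys) = (m ≡ᵇ y) ∨ elemᵇ m ys

mexFrom : ℕ → ℕ → List ℕ → ℕ
mexFrom zero       start S = start
mexFrom (suc fuel) start S =
  if elemᵇ start S then mexFrom fuel (suc start) S else start

-- mex S = least nonnegative integer not in S
-- (the least missing value is at most length S, so length S + 1 candidates suffice)
mex : List ℕ → ℕ
mex S = mexFrom (suc (length S)) 0 S

moves : ℕ → List ℕ
moves n = 2 ∷ 4 * n ∷ 4 * n + 2 ∷ []

index : List ℕ → ℕ → ℕ
index []       _       = 0
index (y ∷ ys) zero    = y
index (y ∷ ys) (suc k) = index ys k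

optionValues : List ℕ → ℕ → List ℕ → List ℕ
optionValues vals x []       = []
optionValues vals x (s ∷ ss) =
  if s ≤ᵇ x then index vals (x ∸ s) ∷ optionValues vals x ss
            else optionValues vals x ss

-- table n x = [G(0), ..., G(x-1)] (course-of-values recursion)
table : ℕ → ℕ → List ℕ
table n zero    = []
table n (suc x) = let t = table n x in snoc t (mex (optionValues t x (moves n)))
  where
    snoc : List ℕ → ℕ → List ℕ
    snoc []       a = a ∷ []
    snoc (y ∷ ys) a = y ∷ snoc ys a

grundy : ℕ → ℕ → ℕ
grundy n x = mex (optionValues (table n x) x (moves n))

{-# OPTIONS --safe #-}
-- Write N = 4n, and let low y and high y be the parities of ⌊y/2⌋ and ⌊y/N⌋. The Grundy
-- value is G(y) = b + 2c with b = low y, c = high y. Adding 2 to y flips b; adding N flips c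
-- and, as 4 ∣ N, keeps b. So for y = z + N + 2 the options z + N, z + 2, z have values
-- b + 2(1-c), (1-b) + 2c', b + 2c (b, c taken at z, c' = high (z + 2)), whose mex is
-- (1-b) + 2(1-c') = G(y); the positions below N + 2 are checked directly, and the recursion
-- determines G. Conversely G(x+2), G(x+N+2) are (1-b) + 2c' and (1-b) + 2(1-c'), and
-- G(x+N) = b + 2(1-c), so their mex is b + 2c = G(x) whatever c' is.
module Submission where

open import Defs
open import Data.Nat using (ℕ; _+_; _*_; _≤_)
open import Data.List using (_∷_; [])
open import Relation.Binary.PropositionalEquality using (_≡_)

open import Data.Bool using (Bool; true; false; not)
open import Data.Bool.Properties using (not-involutive)
open import Data.List using (List; filter; map; length; _++_; [_])
open import Data.List.Properties using (filter-accept; filter-reject; length-++; map-cong)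
open import Data.List.Relation.Unary.All using (All; []; _∷_)
open import Data.Nat using (zero; suc; _∸_; _<_; _<?_; _≤?_; _≤ᵇ_; z≤n; s≤s; z<s; s<s;
                            NonZero; >-nonZero; >-nonZero⁻¹; _/_)
open import Data.Nat.DivMod using (m<n⇒m/n≡0; m/n≡1+[m∸n]/n)
open import Data.Nat.Induction using (<-rec)
open import Data.Nat.Properties
open import Algebra.Properties.CommutativeSemigroup Data.Nat.Properties.+-commutativeSemigroup
  using (xy∙z≈xz∙y)
open import Data.Nat.Tactic.RingSolver using (solve-∀)
open import Data.Sum using (inj₁; inj₂)
open import Function using (_∘_)
open import Relation.Nullary using (yes; no)
open import Relation.Binary.PropositionalEquality
  using (refl; sym; trans; cong; cong₂; subst; _≗_; module ≡-Reasoning)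

open ≡-Reasoning

-- `table` appends with a helper local to its `where` block, which cannot be named;
-- once its arguments are abstracted, unification names it for us.
mutual
  tableSnoc : ℕ → ℕ → List ℕ → ℕ → List ℕ
  tableSnoc = _

  table-suc-snoc : ∀ n x → table n (suc x) ≡ tableSnoc n x (table n x) (grundy n x)
  table-suc-snoc n x with table n x
  ... | t with mex (optionValues t x (moves n))
  ... | g = refl

tableSnoc-++ : ∀ n x xs a → tableSnoc n x xs a ≡ xs ++ [ a ]
tableSnoc-++ n x []       a = refl
tableSnoc-++ n x (y ∷ ys) a = cong (y ∷_) (tableSnoc-++ n x ys a)

table-suc : ∀ n x → table n (suc x) ≡ table n x ++ [ grundy n x ]
table-suc n x = trans (table-suc-snoc n x) (tableSnoc-++ n x (table n x) (grundy n x))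

length-table : ∀ n x → length (table n x) ≡ x
length-table n zero    = refl
length-table n (suc x) = begin
  length (table n (suc x))              ≡⟨ cong length (table-suc n x) ⟩
  length (table n x ++ [ grundy n x ])  ≡⟨ length-++ (table n x) ⟩
  length (table n x) + 1                ≡⟨ cong (_+ 1) (length-table n x) ⟩
  x + 1                                 ≡⟨ +-comm x 1 ⟩
  suc x                                 ∎

index-++ˡ : ∀ xs ys {k} → k < length xs → index (xs ++ ys) k ≡ index xs k
index-++ˡ (x ∷ xs) ys {zero}  _         = refl
index-++ˡ (x ∷ xs) ys {suc k} (s<s k<n) = index-++ˡ xs ys k<n

index-++-length : ∀ xs {y} ys → index (xs ++ y ∷ ys) (length xs) ≡ y
index-++-length []       ys = refl
index-++-length (x ∷ xs) ys = index-++-length xs ys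

index-table : ∀ n {x k} → k < x → index (table n x) k ≡ grundy n k
index-table n {suc x} {k} k<1+x rewrite table-suc n x with m<1+n⇒m<n∨m≡n k<1+x
... | inj₁ k<x  = begin
  index (table n x ++ [ grundy n x ]) k  ≡⟨ index-++ˡ (table n x) _ (subst (k <_) (sym (length-table n x)) k<x) ⟩
  index (table n x) k                    ≡⟨ index-table n k<x ⟩
  grundy n k                             ∎
... | inj₂ refl = begin
  index (table n k ++ [ grundy n k ]) k                   ≡⟨ cong (index (table n k ++ [ grundy n k ])) (length-table n k) ⟨
  index (table n k ++ [ grundy n k ]) (length (table n k)) ≡⟨ index-++-length (table n k) [] ⟩
  grundy n k                                               ∎

-- Opaque, so that unification meets `options g x ss` itself rather than its unfolding
-- and can recover `g`.
opaque
  options : (ℕ → ℕ) → ℕ → List ℕ → List ℕ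
  options g x ss = map (λ s → g (x ∸ s)) (filter (_≤? x) ss)

  optionValues≡options : ∀ vals x ss → optionValues vals x ss ≡ options (index vals) x ss
  optionValues≡options vals x []       = refl
  optionValues≡options vals x (s ∷ ss) with s ≤ᵇ x
  ... | true  = cong (index vals (x ∸ s) ∷_) (optionValues≡options vals x ss)
  ... | false = optionValues≡options vals x ss

  options-[] : ∀ {g x} → options g x [] ≡ []
  options-[] = refl

  options-accept : ∀ {g x s ss vs} → s ≤ x → options g x ss ≡ vs → options g x (s ∷ ss) ≡ g (x ∸ s) ∷ vs
  options-accept {x = x} s≤x eq = trans (cong (map _) (filter-accept (_≤? x) s≤x)) (cong (_ ∷_) eq)

  options-reject : ∀ {g x s ss vs} → x < s → options g x ss ≡ vs → options g x (s ∷ ss) ≡ vs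
  options-reject {x = x} x<s eq = trans (cong (map _) (filter-reject (_≤? x) (<⇒≱ x<s))) eq

options-cong : ∀ {g h x ss} → All (0 <_) ss → (∀ {k} → k < x → g k ≡ h k) →
               options g x ss ≡ options h x ss
options-cong []                       g≡h = trans options-[] (sym options-[])
options-cong {g} {h} {x} {s ∷ ss} (s>0 ∷ ss>0) g≡h with s ≤? x
... | no s≰x  = begin
  options g x (s ∷ ss)       ≡⟨ options-reject (≰⇒> s≰x) (options-cong ss>0 g≡h) ⟩
  options h x ss             ≡⟨ options-reject (≰⇒> s≰x) refl ⟨
  options h x (s ∷ ss)       ∎
... | yes s≤x = begin
  options g x (s ∷ ss)       ≡⟨ options-accept s≤x (options-cong ss>0 g≡h) ⟩
  g (x ∸ s) ∷ options h x ss ≡⟨ cong (_∷ _) (g≡h (∸-monoʳ-< s>0 s≤x)) ⟩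
  h (x ∸ s) ∷ options h x ss ≡⟨ options-accept s≤x refl ⟨
  options h x (s ∷ ss)       ∎

IsGrundyFunction : List ℕ → (ℕ → ℕ) → Set
IsGrundyFunction ss g = ∀ x → g x ≡ mex (options g x ss)

IsGrundyFunction-unique : ∀ {ss g h} → All (0 <_) ss →
                          IsGrundyFunction ss g → IsGrundyFunction ss h → ∀ x → g x ≡ h x
IsGrundyFunction-unique {ss} {g} {h} ss>0 g-rec h-rec = <-rec _ λ x g≡h → begin
  g x                  ≡⟨ g-rec x ⟩
  mex (options g x ss) ≡⟨ cong mex (options-cong ss>0 g≡h) ⟩
  mex (options h x ss) ≡⟨ h-rec x ⟨
  h x                  ∎

moves-positive : ∀ n .{{_ : NonZero n}} → All (0 <_) (moves n)
moves-positive n = z<s ∷ >-nonZero⁻¹ (4 * n) {{m*n≢0 4 n}} ∷ <-≤-trans z<s (m≤n+m 2 (4 * n)) ∷ []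

grundy-isGrundyFunction : ∀ n .{{_ : NonZero n}} → IsGrundyFunction (moves n) (grundy n)
grundy-isGrundyFunction n x = begin
  mex (optionValues (table n x) x (moves n))   ≡⟨ cong mex (optionValues≡options (table n x) x (moves n)) ⟩
  mex (options (index (table n x)) x (moves n)) ≡⟨ cong mex (options-cong (moves-positive n) (index-table n {x})) ⟩
  mex (options (grundy n) x (moves n))          ∎

odd : ℕ → Bool
odd zero    = false
odd (suc k) = not (odd k)

module _ {d : ℕ} .{{_ : NonZero d}} where

  odd-/-<d : ∀ {y} → y < d → odd (y / d) ≡ false
  odd-/-<d y<d = cong odd (m<n⇒m/n≡0 y<d)

  odd-/-+d : ∀ y → odd ((y + d) / d) ≡ not (odd (y / d))
  odd-/-+d y = cong odd (begin
    (y + d) / d            ≡⟨ m/n≡1+[m∸n]/n (m≤n+m d y) ⟩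
    suc ((y + d ∸ d) / d)  ≡⟨ cong (λ m → suc (m / d)) (m+n∸n≡m y d) ⟩
    suc (y / d)            ∎)

  odd-/-+2dk : ∀ y k → odd ((y + 2 * d * k) / d) ≡ odd (y / d)
  odd-/-+2dk y zero    = cong (λ m → odd (m / d)) (trans (cong (y +_) (*-zeroʳ (2 * d))) (+-identityʳ y))
  odd-/-+2dk y (suc k) = begin
    odd ((y + 2 * d * suc k) / d)         ≡⟨ cong (λ m → odd (m / d)) (+2d[1+k] y d k) ⟩
    odd ((y + 2 * d * k + d + d) / d)     ≡⟨ odd-/-+d (y + 2 * d * k + d) ⟩
    not (odd ((y + 2 * d * k + d) / d))   ≡⟨ cong not (odd-/-+d (y + 2 * d * k)) ⟩
    not (not (odd ((y + 2 * d * k) / d))) ≡⟨ not-involutive _ ⟩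
    odd ((y + 2 * d * k) / d)             ≡⟨ odd-/-+2dk y k ⟩
    odd (y / d)                           ∎
    where
    +2d[1+k] : ∀ y d k → y + 2 * d * suc k ≡ y + 2 * d * k + d + d
    +2d[1+k] = solve-∀

bits : Bool → Bool → ℕ
bits false false = 0
bits true  false = 1
bits false true  = 2
bits true  true  = 3

mex-bits-single : ∀ b → mex (bits (not b) false ∷ []) ≡ bits b false
mex-bits-single false = refl
mex-bits-single true  = refl

mex-bits-forward : ∀ b c c′ →
  mex (bits b (not c) ∷ bits (not b) c′ ∷ bits b c ∷ []) ≡ bits (not b) (not c′)
mex-bits-forward false false false = refl
mex-bits-forward false false true  = refl
mex-bits-forward false true  false = refl
mex-bits-forward false true  true  = refl
mex-bits-forward true  false false = refl
mex-bits-forward true  false true  = refl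
mex-bits-forward true  true  false = refl
mex-bits-forward true  true  true  = refl

mex-bits-backward : ∀ b c c′ →
  mex (bits (not b) c′ ∷ bits b (not c) ∷ bits (not b) (not c′) ∷ []) ≡ bits b c
mex-bits-backward false false false = refl
mex-bits-backward false false true  = refl
mex-bits-backward false true  false = refl
mex-bits-backward false true  true  = refl
mex-bits-backward true  false false = refl
mex-bits-backward true  false true  = refl
mex-bits-backward true  true  false = refl
mex-bits-backward true  true  true  = refl

mex₃-cong : ∀ {a a′ b b′ c c′} → a ≡ a′ → b ≡ b′ → c ≡ c′ →
            mex (a ∷ b ∷ c ∷ []) ≡ mex (a′ ∷ b′ ∷ c′ ∷ [])
mex₃-cong refl refl refl = refl

module GrundyFormula (n : ℕ) .{{_ : NonZero n}} where

  N : ℕ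
  N = 4 * n

  instance
    N≢0 : NonZero N
    N≢0 = m*n≢0 4 n

  low high : ℕ → Bool
  low  y = odd (y / 2)
  high y = odd (y / N)

  formula : ℕ → ℕ
  formula y = bits (low y) (high y)

  2<N : 2 < N
  2<N = ≤-trans (n≤1+n 3) (*-monoʳ-≤ 4 (>-nonZero⁻¹ n))

  low-+2 : ∀ y → low (y + 2) ≡ not (low y)
  low-+2 = odd-/-+d {2}

  low-∸2 : ∀ {x} → 2 ≤ x → low (x ∸ 2) ≡ not (low x)
  low-∸2 {x} 2≤x = begin
    low (x ∸ 2)             ≡⟨ not-involutive (low (x ∸ 2)) ⟨
    not (not (low (x ∸ 2))) ≡⟨ cong not (low-+2 (x ∸ 2)) ⟨
    not (low (x ∸ 2 + 2))   ≡⟨ cong (not ∘ low) (m∸n+n≡m 2≤x) ⟩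
    not (low x)             ∎

  low-+N : ∀ y → low (y + N) ≡ low y
  low-+N y = odd-/-+2dk {2} y n

  high-+N : ∀ y → high (y + N) ≡ not (high y)
  high-+N = odd-/-+d {N}

  formula-<2 : ∀ {e} → e < 2 → formula e ≡ 0
  formula-<2 e<2 = cong₂ bits (odd-/-<d e<2) (odd-/-<d (<-trans e<2 2<N))

  formula-+2 : ∀ y → formula (y + 2) ≡ bits (not (low y)) (high (y + 2))
  formula-+2 y = cong (λ b → bits b (high (y + 2))) (low-+2 y)

  formula-+N : ∀ y → formula (y + N) ≡ bits (low y) (not (high y))
  formula-+N y = cong₂ bits (low-+N y) (high-+N y)

  formula-+N+2 : ∀ y → formula (y + N + 2) ≡ bits (not (low y)) (not (high (y + 2)))
  formula-+N+2 y = begin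
    formula (y + N + 2)                     ≡⟨ cong formula (xy∙z≈xz∙y y N 2) ⟩
    formula (y + 2 + N)                     ≡⟨ formula-+N (y + 2) ⟩
    bits (low (y + 2)) (not (high (y + 2))) ≡⟨ cong (λ b → bits b (not (high (y + 2)))) (low-+2 y) ⟩
    bits (not (low y)) (not (high (y + 2))) ∎

  formula-backward : ∀ x →
    formula x ≡ mex (formula (x + 2) ∷ formula (x + N) ∷ formula (x + N + 2) ∷ [])
  formula-backward x = begin
    formula x
      ≡⟨ mex-bits-backward (low x) (high x) (high (x + 2)) ⟨
    mex (bits (not (low x)) (high (x + 2)) ∷ bits (low x) (not (high x)) ∷
         bits (not (low x)) (not (high (x + 2))) ∷ [])
      ≡⟨ mex₃-cong (formula-+2 x) (formula-+N x) (formula-+N+2 x) ⟨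
    mex (formula (x + 2) ∷ formula (x + N) ∷ formula (x + N + 2) ∷ []) ∎

  N<N+2 : N < N + 2
  N<N+2 = m<m+n N z<s

  formula-no-move : ∀ {x} → x < 2 → formula x ≡ mex (options formula x (moves n))
  formula-no-move {x} x<2 = begin
    formula x                         ≡⟨ formula-<2 x<2 ⟩
    mex []                            ≡⟨ cong mex no-options ⟨
    mex (options formula x (moves n)) ∎
    where
    x<N : x < N
    x<N = <-trans x<2 2<N

    no-options : options formula x (moves n) ≡ []
    no-options = options-reject x<2 (options-reject x<N (options-reject (<-trans x<N N<N+2) options-[]))

  formula-one-move : ∀ {x} → 2 ≤ x → x < N → formula x ≡ mex (options formula x (moves n))
  formula-one-move {x} 2≤x x<N = begin
    formula x                                ≡⟨ cong (bits (low x)) (odd-/-<d x<N) ⟩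
    bits (low x) false                       ≡⟨ mex-bits-single (low x) ⟨
    mex (bits (not (low x)) false ∷ [])      ≡⟨ cong (λ b → mex (bits b false ∷ [])) (low-∸2 2≤x) ⟨
    mex (bits (low (x ∸ 2)) false ∷ [])      ≡⟨ cong (λ c → mex (bits (low (x ∸ 2)) c ∷ [])) (odd-/-<d x∸2<N) ⟨
    mex (formula (x ∸ 2) ∷ [])               ≡⟨ cong mex one-option ⟨
    mex (options formula x (moves n))        ∎
    where
    x∸2<N : x ∸ 2 < N
    x∸2<N = ≤-<-trans (m∸n≤m x 2) x<N

    one-option : options formula x (moves n) ≡ formula (x ∸ 2) ∷ []
    one-option = options-accept 2≤x (options-reject x<N (options-reject (<-trans x<N N<N+2) options-[]))

  formula-two-moves : ∀ {x} → N ≤ x → x < N + 2 → formula x ≡ mex (options formula x (moves n))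
  formula-two-moves {x} N≤x x<N+2 = begin
    formula x                                    ≡⟨ cong formula e+N≡x ⟨
    formula (e + N)                              ≡⟨ formula-+N e ⟩
    bits (low e) (not (high e))                  ≡⟨ cong₂ bits low-e (cong not (odd-/-<d e<N)) ⟩
    bits false true                              ≡⟨⟩
    mex (bits true false ∷ bits false false ∷ []) ≡⟨ cong₂ (λ u v → mex (u ∷ v ∷ [])) formula-x∸2 (formula-<2 e<2) ⟨
    mex (formula (x ∸ 2) ∷ formula e ∷ [])       ≡⟨ cong mex two-options ⟨
    mex (options formula x (moves n))            ∎
    where
    e : ℕ
    e = x ∸ N

    e+N≡x : e + N ≡ x
    e+N≡x = m∸n+n≡m N≤x

    e<2 : e < 2
    e<2 = subst (e <_) (m+n∸m≡n N 2) (∸-monoˡ-< x<N+2 N≤x)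

    e<N : e < N
    e<N = <-trans e<2 2<N

    2≤x : 2 ≤ x
    2≤x = ≤-trans (<⇒≤ 2<N) N≤x

    low-e : low e ≡ false
    low-e = odd-/-<d e<2

    formula-x∸2 : formula (x ∸ 2) ≡ bits true false
    formula-x∸2 = cong₂ bits low-x∸2 (odd-/-<d x∸2<N)
      where
      low-x∸2 : low (x ∸ 2) ≡ true
      low-x∸2 = begin
        low (x ∸ 2)       ≡⟨ low-∸2 2≤x ⟩
        not (low x)       ≡⟨ cong (not ∘ low) e+N≡x ⟨
        not (low (e + N)) ≡⟨ cong not (trans (low-+N e) low-e) ⟩
        true              ∎

      x∸2<N : x ∸ 2 < N
      x∸2<N = subst (x ∸ 2 <_) (m+n∸n≡m N 2) (∸-monoˡ-< x<N+2 2≤x)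

    two-options : options formula x (moves n) ≡ formula (x ∸ 2) ∷ formula e ∷ []
    two-options = options-accept 2≤x (options-accept N≤x (options-reject x<N+2 options-[]))

  formula-three-moves : ∀ {x} → N + 2 ≤ x → formula x ≡ mex (options formula x (moves n))
  formula-three-moves {x} N+2≤x = begin
    formula x
      ≡⟨ cong formula x≡z+N+2 ⟩
    formula (z + N + 2)
      ≡⟨ formula-+N+2 z ⟩
    bits (not (low z)) (not (high (z + 2)))
      ≡⟨ mex-bits-forward (low z) (high z) (high (z + 2)) ⟨
    mex (bits (low z) (not (high z)) ∷ bits (not (low z)) (high (z + 2)) ∷ bits (low z) (high z) ∷ [])
      ≡⟨ mex₃-cong (formula-+N z) (formula-+2 z) (refl {x = formula z}) ⟨
    mex (formula (z + N) ∷ formula (z + 2) ∷ formula z ∷ [])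
      ≡⟨ mex₃-cong (cong formula x∸2≡z+N) (cong formula x∸N≡z+2) (refl {x = formula z}) ⟨
    mex (formula (x ∸ 2) ∷ formula (x ∸ N) ∷ formula z ∷ [])
      ≡⟨ cong mex three-options ⟨
    mex (options formula x (moves n))
      ∎
    where
    z : ℕ
    z = x ∸ (N + 2)

    x≡z+N+2 : x ≡ z + N + 2
    x≡z+N+2 = trans (sym (m∸n+n≡m N+2≤x)) (sym (+-assoc z N 2))

    x∸2≡z+N : x ∸ 2 ≡ z + N
    x∸2≡z+N = trans (cong (_∸ 2) x≡z+N+2) (m+n∸n≡m (z + N) 2)

    x∸N≡z+2 : x ∸ N ≡ z + 2
    x∸N≡z+2 = trans (cong (_∸ N) (trans x≡z+N+2 (xy∙z≈xz∙y z N 2))) (m+n∸n≡m (z + 2) N)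

    2≤x : 2 ≤ x
    2≤x = ≤-trans (m≤n+m 2 N) N+2≤x

    N≤x : N ≤ x
    N≤x = ≤-trans (m≤m+n N 2) N+2≤x

    three-options : options formula x (moves n) ≡ formula (x ∸ 2) ∷ formula (x ∸ N) ∷ formula z ∷ []
    three-options = options-accept 2≤x (options-accept N≤x (options-accept N+2≤x options-[]))

  formula-isGrundyFunction : IsGrundyFunction (moves n) formula
  formula-isGrundyFunction x with x <? 2 | x <? N | x <? N + 2
  ... | yes x<2 | _       | _         = formula-no-move x<2
  ... | no x≮2  | yes x<N | _         = formula-one-move (≮⇒≥ x≮2) x<N
  ... | no _    | no x≮N  | yes x<N+2 = formula-two-moves (≮⇒≥ x≮N) x<N+2
  ... | no _    | no _    | no x≮N+2  = formula-three-moves (≮⇒≥ x≮N+2)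

  grundy≗formula : grundy n ≗ formula
  grundy≗formula = IsGrundyFunction-unique (moves-positive n) (grundy-isGrundyFunction n) formula-isGrundyFunction

theorem11 : (n : ℕ) → 3 ≤ n → (x : ℕ) →
    grundy n x ≡ mex (grundy n (x + 2) ∷ grundy n (x + 4 * n) ∷ grundy n (x + 4 * n + 2) ∷ [])
theorem11 n 3≤n x = begin
  grundy n x                     ≡⟨ grundy≗formula x ⟩
  formula x                      ≡⟨ formula-backward x ⟩
  mex (map formula positions)    ≡⟨ cong mex (map-cong grundy≗formula positions) ⟨
  mex (map (grundy n) positions) ∎
  where
  -- The argument works for every n ≥ 1; the hypothesis 3 ≤ n is only used to make n nonzero.
  instance
    n≢0 : NonZero n
    n≢0 = >-nonZero (≤-trans (s≤s z≤n) 3≤n)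

  open GrundyFormula n

  positions : List ℕ
  positions = x + 2 ∷ x + 4 * n ∷ x + 4 * n + 2 ∷ []
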